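{- Let $(G,\sigma)$ be a flow-admissible signed cubic graph with $N_\sigma=\{uv,xy\}$, and let $G^*=(V(G),E(G)\cup\{ux\}\setminus\{uv,xy\})$ be the unsigned graph obtained by deleting $uv$ and $xy$ and adding a new edge $ux$. If $G^*$ admits a nowhere-zero $k$-flow for some integer $k$ in which $ux$ receives flow value $1$, then $(G,\sigma)$ admits a nowhere-zero $(k+1)$-flow $(D,\phi)$ with the following properties: (1) $\phi(e)>0$ for every $e\in E(G)$; (2) $\phi(uv)=\phi(xy)=1$; (3) there exists a $v$-$y$-path $P$ in $G$ such that $\phi^{ -1}(k)\subseteq E(P)$ and $\phi^{ -1}(1)\cap E(P)=\emptyset$.
   Context: Graphs are finite and may have parallel edges. A signed graph $(G,\sigma)$ is a graph $G$ with a map $\sigma:E(G)\to\{ -1,1\}$; $N_\sigma=\sigma^{ -1}(-1)$ is the set of negative edges, the others are positive. Each edge $e=vw$ consists of two half-edges $h_v(e)$, $h_w(e)$. An orientation $D$ of $(G,\sigma)$ directs each half-edge either towards or away from its end vertex so that for a positive edge exactly one of its two half-edges is directed towards its end vertex, while for a negative edge either both half-edges are directed away from their end vertices or both towards them. A $\mathbb{Z}$-flow $(D,\phi)$ is an orientation $D$ with $\phi:E(G)\to\mathbb{Z}$ such that at every vertex $v$ the sum of $\phi(e)$ over half-edges at $v$ directed towards $v$ equals the sum over half-edges at $v$ directed away from $v$. A nowhere-zero $k$-flow is a $\mathbb{Z}$-flow with $0<|\phi(e)|<k$ for all $e$. Flows on an unsigned graph are flows on it with all edges positive (ordinary flows).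 $(G,\sigma)$ is flow-admissible if it admits a nowhere-zero $k$-flow for some $k$. -}

module Defs where

open import Data.Nat using (ℕ; zero; suc)
import Data.Nat as N
open import Data.Integer using (ℤ; +_; -_; _<_; ∣_∣) renaming (_+_ to _+ℤ_)
open import Data.Fin using (Fin; zero; suc; punchIn; punchOut; _≟_)
open import Data.Bool using (Bool; true; false; not; _∧_; if_then_else_)
open import Data.Product using (Σ; _×_; _,_; ∃)
open import Data.Sum using (_⊎_)
open import Data.List using (List; []; _∷_)
open import Data.List.Membership.Propositional using (_∈_)
open import Data.List.Relation.Unary.Unique.Propositional using (Unique)
open import Relation.Nullary using (¬_)
open import Relation.Nullary.Decidable using (⌊_⌋)
open import Relation.Binary.PropositionalEquality using (_≡_; _≢_)

-- Each edge e has two half-edges (e , false) and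
-- (e , true); the half-edge (e , b) is incident with the vertex  end e b.
record Graph (n m : ℕ) : Set where
  constructor mkGraph
  field
    end : Fin m → Bool → Fin n
open Graph public

sumℕ : ∀ {m} → (Fin m → ℕ) → ℕ
sumℕ {zero}  f = 0
sumℕ {suc m} f = f zero N.+ sumℕ (λ i → f (suc i))

sumℤ : ∀ {m} → (Fin m → ℤ) → ℤ
sumℤ {zero}  f = + 0
sumℤ {suc m} f = f zero +ℤ sumℤ (λ i → f (suc i))

-- degree: number of half-edges at v (a loop counts twice)
degree : ∀ {n m} → Graph n m → Fin n → ℕ
degree G v = sumℕ (λ e → ind (end G e false) N.+ ind (end G e true))
  where
    ind : _ → ℕ
    ind w = if ⌊ w ≟ v ⌋ then 1 else 0

Cubic : ∀ {n m} → Graph n m → Set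
Cubic G = ∀ v → degree G v ≡ 3

data Sign : Set where
  pos neg : Sign

Signature : ℕ → Set
Signature m = Fin m → Sign

allPositive : ∀ {m} → Signature m
allPositive _ = pos

-- orientation: D e b = true  iff the half-edge (e , b) is directed
-- towards its end vertex
Orientation : ℕ → Set
Orientation m = Fin m → Bool → Bool

IsOrientation : ∀ {m} → Signature m → Orientation m → Set
IsOrientation σ D = ∀ e → Cond (σ e) e
  where
    Cond : Sign → _ → Set
    Cond pos e = D e false ≡ not (D e true)
    Cond neg e = D e false ≡ D e true

inflow : ∀ {n m} → Graph n m → Orientation m → (Fin m → ℤ) → Fin n → ℤ
inflow G D φ v = sumℤ (λ e → h e false +ℤ h e true)
  where
    h : _ → Bool → ℤ
    h e b = if ⌊ end G e b ≟ v ⌋ ∧ D e b then φ e else + 0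

outflow : ∀ {n m} → Graph n m → Orientation m → (Fin m → ℤ) → Fin n → ℤ
outflow G D φ v = sumℤ (λ e → h e false +ℤ h e true)
  where
    h : _ → Bool → ℤ
    h e b = if ⌊ end G e b ≟ v ⌋ ∧ not (D e b) then φ e else + 0

IsFlow : ∀ {n m} → Graph n m → Signature m → Orientation m → (Fin m → ℤ) → Set
IsFlow G σ D φ = IsOrientation σ D × (∀ v → inflow G D φ v ≡ outflow G D φ v)

IsNZFlow : ∀ {n m} → Graph n m → Signature m → ℤ → Orientation m → (Fin m → ℤ) → Set
IsNZFlow G σ k D φ = IsFlow G σ D φ × (∀ e → (φ e ≢ + 0) × (+ ∣ φ e ∣ < k))

FlowAdmissible : ∀ {n m} → Graph n m → Signature m → Set
FlowAdmissible G σ = Σ ℤ λ k → Σ (Orientation _) λ D → Σ (Fin _ → ℤ) λ φ → IsNZFlow G σ k D φ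

data Walk {n m} (G : Graph n m) : Fin n → Fin n → Set where
  [] : ∀ {a} → Walk G a a
  step : ∀ {a c} (e : Fin m) (b : Bool) → end G e b ≡ a →
         Walk G (end G e (not b)) c → Walk G a c

walkVertices : ∀ {n m} {G : Graph n m} {a c} → Walk G a c → List (Fin n)
walkVertices {a = a} []           = a ∷ []
walkVertices {a = a} (step e b _ w) = a ∷ walkVertices w

walkEdges : ∀ {n m} {G : Graph n m} {a c} → Walk G a c → List (Fin m)
walkEdges []             = []
walkEdges (step e _ _ w) = e ∷ walkEdges w

IsPath : ∀ {n m} {G : Graph n m} {a c} → Walk G a c → Set
IsPath w = Unique (walkVertices w)

HasEnds : ∀ {n m} → Graph n m → Fin m → Fin n → Fin n → Set
HasEnds G e a c = (end G e false ≡ a × end G e true ≡ c) ⊎ (end G e false ≡ c × end G e true ≡ a)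

-- G* : delete the distinct edges e₁ e₂ and add a new edge  a c  (edge zero).
-- The remaining edges are enumerated by  skip : Fin m → Fin (2+m).
skip2 : ∀ {m} (e₁ e₂ : Fin (suc (suc m))) → e₁ ≢ e₂ → Fin m → Fin (suc (suc m))
skip2 e₁ e₂ ne i = punchIn e₁ (punchIn (punchOut ne) i)

Gstar : ∀ {n m} (G : Graph n (suc (suc m))) (e₁ e₂ : Fin (suc (suc m))) → e₁ ≢ e₂ →
        Fin n → Fin n → Graph n (suc m)
Gstar G e₁ e₂ ne a c = mkGraph E
  where
    E : Fin _ → Bool → Fin _
    E zero    false = a
    E zero    true  = c
    E (suc i) b     = end G (skip2 e₁ e₂ ne i) b

-- Normalise the flow on G* so that it is positive and ux carries 1 from x into u, and carry it over
-- to G: keep it on the common edges and put 1 on uv and on xy, with uv pointing into both of its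
-- ends and xy out of both.  The result φ₀ has 1 ≤ φ₀ < k and is conserved except for one unit of
-- excess inflow at v and one of excess outflow at y.  Let T be the set of vertices from which y is
-- reachable along positive edges in their direction.  If v ∉ T, switch at the vertices outside T:
-- then no edge points into both of its ends, and weighting the net inflow of φ₀ by ±1 according
-- to T shows that the edges pointing out of both ends carry φ₀-total 1.  So exactly one edge
-- is negative after switching, which no flow-admissible signed graph allows (the excesses of a
-- flow cancel).  Hence some directed positive path P runs from v to y, and φ₀ + 1_P is the
-- required flow: it reaches k only on P and is at least 2 there.

module Submission where

open import Defs
open import Data.Nat as ℕ using (ℕ; zero; suc; _≤_; _<_; z≤n; s≤s)
import Data.Nat.Properties as ℕ
open import Data.Integer using (ℤ; +_; -_; _+_; _-_; _*_; +0; -[1+_]; ∣_∣; 1ℤ; -1ℤ; +<+)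
  renaming (_<_ to _<ℤ_)
open import Data.Integer.Properties as ℤ
  using ( +-*-semiring; +-comm; +-identityˡ; +-identityʳ; +-inverseˡ; +-inverseʳ
        ; *-identityˡ; *-zeroʳ; neg-distrib-+; neg-involutive; -1*i≡-i)
open import Data.Integer.Tactic.RingSolver using (solve-∀)
open import Algebra.Properties.Semiring.Sum +-*-semiring
  using (sum; sum-cong-≗; sum-remove; sum-replicate-zero; ∑-distrib-+; ∑-comm; *-distribˡ-sum)
open import Algebra.Properties.CommutativeSemigroup ℤ.+-commutativeSemigroup using (interchange)
open import Algebra.Properties.AbelianGroup ℤ.+-0-abelianGroup using (∙-cancelʳ; inverseʳ-unique)
open import Data.Fin using (Fin; zero; suc; punchIn; punchOut; _≟_)
open import Data.Fin.Properties using (any?; punchInᵢ≢i; punchIn-injective; punchIn-punchOut; punchOut-injective)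
open import Data.Bool using (Bool; true; false; not; _∧_; _∨_; _xor_; if_then_else_)
import Data.Bool as Bool
open import Data.Bool.Properties using (not-involutive; ∨-zeroʳ)
open import Data.Product using (Σ; _×_; _,_; proj₁; proj₂)
open import Data.Sum using (_⊎_; inj₁; inj₂)
open import Data.Unit using (⊤; tt)
open import Data.List.Membership.Propositional using (_∈_)
open import Data.List.Relation.Unary.Any using (here; there)
open import Data.List.Relation.Unary.All as All using (All; []; _∷_)
open import Data.List.Relation.Unary.AllPairs using ([]; _∷_)
open import Relation.Nullary using (¬_; Dec; yes; no; does; contradiction)
open import Relation.Nullary.Decidable using (⌊_⌋; _×-dec_; dec-true; dec-false; map′)
open import Relation.Binary.PropositionalEquality
open import Function using (_∘_)

private
  variable
    n m : ℕ

sumℤ≡sum : (f : Fin m → ℤ) → sumℤ f ≡ sum f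
sumℤ≡sum {zero}  f = refl
sumℤ≡sum {suc m} f = cong (λ s → f zero + s) (sumℤ≡sum (f ∘ suc))

sum-zero : (f : Fin m → ℤ) → (∀ i → f i ≡ +0) → sum f ≡ +0
sum-zero {m} f f≡0 = trans (sum-cong-≗ f≡0) (sum-replicate-zero m)

sum-neg : (f : Fin m → ℤ) → sum (λ i → - f i) ≡ - sum f
sum-neg {zero}  f = refl
sum-neg {suc m} f = trans (cong (λ s → - f zero + s) (sum-neg (f ∘ suc))) (sym (neg-distrib-+ (f zero) _))

sum-supported-on : (p : Fin m) (f : Fin m → ℤ) → (∀ i → i ≢ p → f i ≡ +0) → sum f ≡ f p
sum-supported-on {suc m} p f f≡0 = begin
  sum f                           ≡⟨ sum-remove {i = p} f ⟩
  f p + sum (f ∘ punchIn p)       ≡⟨ cong (λ s → f p + s) (sum-zero _ (λ i → f≡0 _ (punchInᵢ≢i p i))) ⟩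
  f p + +0                        ≡⟨ +-identityʳ (f p) ⟩
  f p                             ∎
  where open ≡-Reasoning

sum-skip2 : ∀ (e₁ e₂ : Fin (suc (suc m))) (e₁≢e₂ : e₁ ≢ e₂) (f : Fin (suc (suc m)) → ℤ) →
            sum f ≡ f e₁ + (f e₂ + sum (f ∘ skip2 e₁ e₂ e₁≢e₂))
sum-skip2 e₁ e₂ e₁≢e₂ f = begin
  sum f                                                ≡⟨ sum-remove {i = e₁} f ⟩
  f e₁ + sum (f ∘ punchIn e₁)                          ≡⟨ cong (λ s → f e₁ + s) (sum-remove {i = punchOut e₁≢e₂} (f ∘ punchIn e₁)) ⟩
  f e₁ + (f (punchIn e₁ (punchOut e₁≢e₂)) + sum (f ∘ skip2 e₁ e₂ e₁≢e₂))
    ≡⟨ cong (λ e → f e₁ + (f e + sum (f ∘ skip2 e₁ e₂ e₁≢e₂))) (punchIn-punchOut e₁≢e₂) ⟩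
  f e₁ + (f e₂ + sum (f ∘ skip2 e₁ e₂ e₁≢e₂))          ∎
  where open ≡-Reasoning

sum-ℕ : (f : Fin m → ℕ) → sum (λ i → + f i) ≡ + sumℕ f
sum-ℕ {zero}  f = refl
sum-ℕ {suc m} f = cong (λ s → + f zero + s) (sum-ℕ (f ∘ suc))

mass : Fin n → ℤ → Fin n → ℤ
mass a z w = if ⌊ a ≟ w ⌋ then z else +0

mass-+ : ∀ (a : Fin n) z z′ w → mass a (z + z′) w ≡ mass a z w + mass a z′ w
mass-+ a z z′ w with ⌊ a ≟ w ⌋
... | true  = refl
... | false = refl

mass-neg : ∀ (a : Fin n) z w → mass a (- z) w ≡ - mass a z w
mass-neg a z w with ⌊ a ≟ w ⌋
... | true  = refl
... | false = refl

mass-zero : ∀ (a : Fin n) w → mass a +0 w ≡ +0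
mass-zero a w with ⌊ a ≟ w ⌋
... | true  = refl
... | false = refl

sum-*-mass : ∀ (s : Fin n → ℤ) (a : Fin n) z → sum (λ w → s w * mass a z w) ≡ s a * z
sum-*-mass s a z = trans (sum-supported-on a _ off) (on a)
  where
  off : ∀ w → w ≢ a → s w * mass a z w ≡ +0
  off w w≢a with a ≟ w
  ... | yes a≡w = contradiction (sym a≡w) w≢a
  ... | no _    = *-zeroʳ (s w)
  on : ∀ a → s a * mass a z a ≡ s a * z
  on a with a ≟ a
  ... | yes _   = refl
  ... | no a≢a  = contradiction refl a≢a

signed : Bool → ℤ → ℤ
signed true  z = z
signed false z = - z

signed-+ : ∀ d z z′ → signed d (z + z′) ≡ signed d z + signed d z′
signed-+ true  z z′ = refl
signed-+ false z z′ = neg-distrib-+ z z′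

signed-not : ∀ d z → signed (not d) z ≡ - signed d z
signed-not true  z = refl
signed-not false z = sym (neg-involutive z)

halfNet : Graph n m → Orientation m → (Fin m → ℤ) → Fin n → Fin m → Bool → ℤ
halfNet G D φ w e b = mass (end G e b) (signed (D e b) (φ e)) w

edgeNet : Graph n m → Orientation m → (Fin m → ℤ) → Fin n → Fin m → ℤ
edgeNet G D φ w e = halfNet G D φ w e false + halfNet G D φ w e true

net : Graph n m → Orientation m → (Fin m → ℤ) → Fin n → ℤ
net G D φ w = sum (edgeNet G D φ w)

private
  split-inflow : ∀ c d z →
    (if c ∧ d then z else +0) ≡ (if c then signed d z else +0) + (if c ∧ not d then z else +0)
  split-inflow false d     z = refl
  split-inflow true  true  z = sym (+-identityʳ z)
  split-inflow true  false z = sym (+-inverseˡ z)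

inflow≡net+outflow : ∀ (G : Graph n m) D φ w → inflow G D φ w ≡ net G D φ w + outflow G D φ w
inflow≡net+outflow G D φ w = begin
  inflow G D φ w                                    ≡⟨ sumℤ≡sum (λ e → into e false + into e true) ⟩
  sum (λ e → into e false + into e true)            ≡⟨ sum-cong-≗ split ⟩
  sum (λ e → (halfNet G D φ w e false + out e false) + (halfNet G D φ w e true + out e true))
    ≡⟨ sum-cong-≗ (λ e → interchange (halfNet G D φ w e false) (out e false) (halfNet G D φ w e true) (out e true)) ⟩
  sum (λ e → edgeNet G D φ w e + (out e false + out e true))
    ≡⟨ ∑-distrib-+ (edgeNet G D φ w) _ ⟩
  net G D φ w + sum (λ e → out e false + out e true) ≡⟨ cong (λ o → net G D φ w + o) (sumℤ≡sum (λ e → out e false + out e true)) ⟨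
  net G D φ w + outflow G D φ w                     ∎
  where
  open ≡-Reasoning
  into out : Fin _ → Bool → ℤ
  into e b = if ⌊ end G e b ≟ w ⌋ ∧ D e b then φ e else +0
  out e b = if ⌊ end G e b ≟ w ⌋ ∧ not (D e b) then φ e else +0
  split : ∀ e → into e false + into e true ≡ (halfNet G D φ w e false + out e false) + (halfNet G D φ w e true + out e true)
  split e = cong₂ _+_ (split-inflow ⌊ end G e false ≟ w ⌋ (D e false) (φ e))
                      (split-inflow ⌊ end G e true ≟ w ⌋ (D e true) (φ e))

conserved⇒net≡0 : ∀ (G : Graph n m) D φ w → inflow G D φ w ≡ outflow G D φ w → net G D φ w ≡ +0
conserved⇒net≡0 G D φ w in≡out = ∙-cancelʳ (outflow G D φ w) _ _
  (trans (sym (inflow≡net+outflow G D φ w)) (trans in≡out (sym (+-identityˡ _))))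

net≡0⇒conserved : ∀ (G : Graph n m) D φ w → net G D φ w ≡ +0 → inflow G D φ w ≡ outflow G D φ w
net≡0⇒conserved G D φ w net≡0 =
  trans (inflow≡net+outflow G D φ w) (trans (cong (_+ outflow G D φ w) net≡0) (+-identityˡ _))

net-+ : ∀ (G : Graph n m) D (φ ψ : Fin m → ℤ) w → net G D (λ e → φ e + ψ e) w ≡ net G D φ w + net G D ψ w
net-+ G D φ ψ w = trans (sum-cong-≗ edge) (∑-distrib-+ (edgeNet G D φ w) (edgeNet G D ψ w))
  where
  half : ∀ e b → halfNet G D (λ e → φ e + ψ e) w e b ≡ halfNet G D φ w e b + halfNet G D ψ w e b
  half e b = trans (cong (λ z → mass (end G e b) z w) (signed-+ (D e b) (φ e) (ψ e)))
                   (mass-+ (end G e b) (signed (D e b) (φ e)) (signed (D e b) (ψ e)) w)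
  edge : ∀ e → edgeNet G D (λ e → φ e + ψ e) w e ≡ edgeNet G D φ w e + edgeNet G D ψ w e
  edge e = trans (cong₂ _+_ (half e false) (half e true))
                 (interchange (halfNet G D φ w e false) (halfNet G D ψ w e false)
                              (halfNet G D φ w e true) (halfNet G D ψ w e true))

reverse : Orientation m → Orientation m
reverse D e b = not (D e b)

net-reverse : ∀ (G : Graph n m) D φ w → net G (reverse D) φ w ≡ - net G D φ w
net-reverse G D φ w = trans (sum-cong-≗ edge) (sum-neg (edgeNet G D φ w))
  where
  half : ∀ e b → halfNet G (reverse D) φ w e b ≡ - halfNet G D φ w e b
  half e b = trans (cong (λ z → mass (end G e b) z w) (signed-not (D e b) (φ e)))
                   (mass-neg (end G e b) (signed (D e b) (φ e)) w)
  edge : ∀ e → edgeNet G (reverse D) φ w e ≡ - edgeNet G D φ w e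
  edge e = trans (cong₂ _+_ (half e false) (half e true))
                 (sym (neg-distrib-+ (halfNet G D φ w e false) (halfNet G D φ w e true)))

private
  alignWith : ℤ → Bool → Bool
  alignWith (+ _)      d = d
  alignWith -[1+ _ ] d = not d

  signed-alignWith : ∀ z d → signed (alignWith z d) (+ ∣ z ∣) ≡ signed d z
  signed-alignWith (+ _)      d     = refl
  signed-alignWith -[1+ _ ] true  = refl
  signed-alignWith -[1+ _ ] false = refl

-- reverse the edges carrying negative flow, so that ∣ φ ∣ flows the same way as φ
align : Orientation m → (Fin m → ℤ) → Orientation m
align D φ e b = alignWith (φ e) (D e b)

net-align : ∀ (G : Graph n m) D φ w → net G (align D φ) (λ e → + ∣ φ e ∣) w ≡ net G D φ w
net-align G D φ w = sum-cong-≗ λ e →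
  cong₂ _+_ (cong (λ z → mass (end G e false) z w) (signed-alignWith (φ e) (D e false)))
            (cong (λ z → mass (end G e true) z w) (signed-alignWith (φ e) (D e true)))

signed-zero : ∀ d → signed d +0 ≡ +0
signed-zero true  = refl
signed-zero false = refl

edgeNet-zero : ∀ (G : Graph n m) D φ w e → φ e ≡ +0 → edgeNet G D φ w e ≡ +0
edgeNet-zero G D φ w e φe≡0 = cong₂ _+_ (half false) (half true)
  where
  half : ∀ b → halfNet G D φ w e b ≡ +0
  half b = trans (cong (λ z → mass (end G e b) (signed (D e b) z) w) φe≡0)
                 (trans (cong (λ z → mass (end G e b) z w) (signed-zero (D e b))) (mass-zero (end G e b) w))

net-zero : ∀ (G : Graph n m) D w → net G D (λ _ → +0) w ≡ +0
net-zero G D w = sum-zero _ (λ e → edgeNet-zero G D (λ _ → +0) w e refl)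

net-supported-on : ∀ (G : Graph n m) D φ w p → (∀ e → e ≢ p → φ e ≡ +0) → net G D φ w ≡ edgeNet G D φ w p
net-supported-on G D φ w p φ≡0 = sum-supported-on p (edgeNet G D φ w) λ e e≢p → edgeNet-zero G D φ w e (φ≡0 e e≢p)

sum-weighted-net : ∀ (G : Graph n m) D φ (s : Fin n → ℤ) →
  sum (λ w → s w * net G D φ w) ≡
  sum (λ e → s (end G e false) * signed (D e false) (φ e) + s (end G e true) * signed (D e true) (φ e))
sum-weighted-net G D φ s = begin
  sum (λ w → s w * net G D φ w)                    ≡⟨ sum-cong-≗ (λ w → *-distribˡ-sum (s w) (edgeNet G D φ w)) ⟩
  sum (λ w → sum (λ e → s w * edgeNet G D φ w e))  ≡⟨ ∑-comm (λ w e → s w * edgeNet G D φ w e) ⟩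
  sum (λ e → sum (λ w → s w * edgeNet G D φ w e))  ≡⟨ sum-cong-≗ edge ⟩
  sum (λ e → s (end G e false) * signed (D e false) (φ e) + s (end G e true) * signed (D e true) (φ e)) ∎
  where
  open ≡-Reasoning
  edge : ∀ e → sum (λ w → s w * edgeNet G D φ w e) ≡
               s (end G e false) * signed (D e false) (φ e) + s (end G e true) * signed (D e true) (φ e)
  edge e = begin
    sum (λ w → s w * edgeNet G D φ w e)
      ≡⟨ sum-cong-≗ (λ w → ℤ.*-distribˡ-+ (s w) (halfNet G D φ w e false) (halfNet G D φ w e true)) ⟩
    sum (λ w → s w * halfNet G D φ w e false + s w * halfNet G D φ w e true)
      ≡⟨ ∑-distrib-+ (λ w → s w * halfNet G D φ w e false) (λ w → s w * halfNet G D φ w e true) ⟩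
    sum (λ w → s w * halfNet G D φ w e false) + sum (λ w → s w * halfNet G D φ w e true)
      ≡⟨ cong₂ _+_ (sum-*-mass s (end G e false) (signed (D e false) (φ e)))
                   (sum-*-mass s (end G e true) (signed (D e true) (φ e))) ⟩
    s (end G e false) * signed (D e false) (φ e) + s (end G e true) * signed (D e true) (φ e) ∎

sum-*-dipole : ∀ (s : Fin n → ℤ) a b → sum (λ w → s w * (mass a 1ℤ w - mass b 1ℤ w)) ≡ s a - s b
sum-*-dipole s a b = begin
  sum (λ w → s w * (mass a 1ℤ w - mass b 1ℤ w))         ≡⟨ sum-cong-≗ (λ w → cong (λ z → s w * (mass a 1ℤ w + z)) (mass-neg b 1ℤ w)) ⟨
  sum (λ w → s w * (mass a 1ℤ w + mass b -1ℤ w))        ≡⟨ sum-cong-≗ (λ w → ℤ.*-distribˡ-+ (s w) (mass a 1ℤ w) (mass b -1ℤ w)) ⟩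
  sum (λ w → s w * mass a 1ℤ w + s w * mass b -1ℤ w)    ≡⟨ ∑-distrib-+ (λ w → s w * mass a 1ℤ w) (λ w → s w * mass b -1ℤ w) ⟩
  sum (λ w → s w * mass a 1ℤ w) + sum (λ w → s w * mass b -1ℤ w)
    ≡⟨ cong₂ _+_ (sum-*-mass s a 1ℤ) (sum-*-mass s b -1ℤ) ⟩
  s a * 1ℤ + s b * -1ℤ                                  ≡⟨ cong₂ _+_ (ℤ.*-identityʳ (s a)) (trans (ℤ.*-comm (s b) -1ℤ) (ℤ.-1*i≡-i (s b))) ⟩
  s a - s b                                             ∎
  where open ≡-Reasoning

-- Switching

OrientedAs : Sign → Bool → Bool → Set
OrientedAs pos d₀ d₁ = d₀ ≡ not d₁
OrientedAs neg d₀ d₁ = d₀ ≡ d₁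

orientedAs : ∀ {σ : Signature m} {D} → IsOrientation σ D → ∀ e → OrientedAs (σ e) (D e false) (D e true)
orientedAs {σ = σ} o e with σ e | o e
... | pos | oₑ = oₑ
... | neg | oₑ = oₑ

isOrientation : ∀ {σ : Signature m} {D} → (∀ e → OrientedAs (σ e) (D e false) (D e true)) → IsOrientation σ D
isOrientation {σ = σ} o e with σ e | o e
... | pos | oₑ = oₑ
... | neg | oₑ = oₑ

flip : Sign → Sign
flip pos = neg
flip neg = pos

crosses : Graph n m → (Fin n → Bool) → Fin m → Bool
crosses G T e = T (end G e false) xor T (end G e true)

switchSign : Graph n m → (Fin n → Bool) → Signature m → Signature m
switchSign G T σ e = if crosses G T e then flip (σ e) else σ e

switchAt : Bool → Bool → Bool
switchAt t d = if t then d else not d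

switchAt≡true : ∀ t d → switchAt t d ≡ true → t ≡ d
switchAt≡true true  true  _ = refl
switchAt≡true false false _ = refl

-- switching at the vertices outside T: their half-edges are reversed
switch : Graph n m → (Fin n → Bool) → Orientation m → Orientation m
switch G T D e b = switchAt (T (end G e b)) (D e b)

switchAt-oriented : ∀ s t₀ t₁ {d₀ d₁} → OrientedAs s d₀ d₁ →
                    OrientedAs (if t₀ xor t₁ then flip s else s) (switchAt t₀ d₀) (switchAt t₁ d₁)
switchAt-oriented pos true  true  refl = refl
switchAt-oriented pos true  false refl = refl
switchAt-oriented pos false true  {d₁ = d₁} refl = not-involutive d₁
switchAt-oriented pos false false refl = refl
switchAt-oriented neg true  true  refl = refl
switchAt-oriented neg true  false {d₁ = d₁} refl = sym (not-involutive d₁)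
switchAt-oriented neg false true  refl = refl
switchAt-oriented neg false false refl = refl

switch-isOrientation : ∀ (G : Graph n m) T {σ D} → IsOrientation σ D → IsOrientation (switchSign G T σ) (switch G T D)
switch-isOrientation G T {σ} o = isOrientation λ e →
  switchAt-oriented (σ e) (T (end G e false)) (T (end G e true)) (orientedAs o e)

sgn : Bool → ℤ
sgn true  = 1ℤ
sgn false = -1ℤ

sgn-*-signed : ∀ t d z → sgn t * signed d z ≡ signed (switchAt t d) z
sgn-*-signed true  d z = *-identityˡ (signed d z)
sgn-*-signed false d z = trans (-1*i≡-i (signed d z)) (sym (signed-not d z))

edgeExcess : Orientation m → (Fin m → ℤ) → Fin m → ℤ
edgeExcess D φ e = signed (D e false) (φ e) + signed (D e true) (φ e)

sum-sgn-net : ∀ (G : Graph n m) T D φ → sum (λ w → sgn (T w) * net G D φ w) ≡ sum (edgeExcess (switch G T D) φ)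
sum-sgn-net G T D φ = trans (sum-weighted-net G D φ (sgn ∘ T)) (sum-cong-≗ λ e →
  cong₂ _+_ (sgn-*-signed (T (end G e false)) (D e false) (φ e))
            (sgn-*-signed (T (end G e true)) (D e true) (φ e)))

excess-positive : ∀ {d₀ d₁} z → OrientedAs pos d₀ d₁ → signed d₀ z + signed d₁ z ≡ +0
excess-positive {d₁ = true}  z refl = +-inverseˡ z
excess-positive {d₁ = false} z refl = +-inverseʳ z

private
  double≡0 : ∀ z → z + z ≡ +0 → z ≡ +0
  double≡0 (+ zero) _ = refl

excess-negative : ∀ {d₀ d₁} z → OrientedAs neg d₀ d₁ → z ≢ +0 → signed d₀ z + signed d₁ z ≢ +0
excess-negative {d₁ = true}  z refl z≢0 z+z≡0 = z≢0 (double≡0 z z+z≡0)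
excess-negative {d₁ = false} z refl z≢0 -z-z≡0 =
  z≢0 (trans (sym (neg-involutive z)) (cong -_ (double≡0 (- z) -z-z≡0)))

ExactlyOneNegative : Signature m → Set
ExactlyOneNegative {m} σ = Σ (Fin m) λ p → σ p ≡ neg × (∀ e → σ e ≡ neg → e ≡ p)

-- The excesses of a flow sum to zero, while a lone negative edge would have nonzero excess.
switchSign-exactlyOneNegative⇒¬admissible :
  ∀ (G : Graph n m) σ T → FlowAdmissible G σ → ¬ ExactlyOneNegative (switchSign G T σ)
switchSign-exactlyOneNegative⇒¬admissible {m = m} G σ T (_ , D , χ , (o , conserved) , nowhere-zero) (p , p-neg , only-p) =
  excess-negative (χ p) (subst (λ s → OrientedAs s (D′ p false) (D′ p true)) p-neg (orientedAs o′ p))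
                  (proj₁ (nowhere-zero p)) excess-p≡0
  where
  open ≡-Reasoning
  D′ : Orientation m
  D′ = switch G T D
  o′ : IsOrientation (switchSign G T σ) D′
  o′ = switch-isOrientation G T o
  vanish : ∀ e → e ≢ p → edgeExcess D′ χ e ≡ +0
  vanish e e≢p with switchSign G T σ e | orientedAs o′ e | only-p e
  ... | pos | oₑ | _    = excess-positive (χ e) oₑ
  ... | neg | _  | only = contradiction (only refl) e≢p
  excess-p≡0 : edgeExcess D′ χ p ≡ +0
  excess-p≡0 = begin
    edgeExcess D′ χ p                     ≡⟨ sum-supported-on p (edgeExcess D′ χ) vanish ⟨
    sum (edgeExcess D′ χ)                 ≡⟨ sum-sgn-net G T D χ ⟨
    sum (λ w → sgn (T w) * net G D χ w)   ≡⟨ sum-zero _ (λ w → trans (cong (sgn (T w) *_) (conserved⇒net≡0 G D χ w (conserved w)))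
                                                                     (*-zeroʳ (sgn (T w)))) ⟩
    +0                                    ∎

sumℕ≡0 : (f : Fin m → ℕ) → sumℕ f ≡ 0 → ∀ e → f e ≡ 0
sumℕ≡0 f Σf≡0 zero    = ℕ.m+n≡0⇒m≡0 (f zero) Σf≡0
sumℕ≡0 f Σf≡0 (suc e) = sumℕ≡0 (f ∘ suc) (ℕ.m+n≡0⇒n≡0 (f zero) Σf≡0) e

sumℕ≡1 : (f : Fin m → ℕ) → sumℕ f ≡ 1 → Σ (Fin m) λ p → f p ≡ 1 × (∀ e → e ≢ p → f e ≡ 0)
sumℕ≡1 {suc m} f Σf≡1 with f zero in f₀
... | zero with sumℕ≡1 (f ∘ suc) Σf≡1
...   | p , fp≡1 , rest = suc p , fp≡1 , λ { zero _ → f₀ ; (suc e) e≢p → rest e (e≢p ∘ cong suc) }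
sumℕ≡1 {suc m} f Σf≡1 | suc zero =
  zero , f₀ , λ { zero 0≢0 → contradiction refl 0≢0 ; (suc e) _ → sumℕ≡0 (f ∘ suc) (ℕ.suc-injective Σf≡1) e }

private
  onNegative : Sign → ℕ → ℕ
  onNegative pos _ = 0
  onNegative neg k = k

  excess-not-in-in : ∀ s {d₀ d₁} k → OrientedAs s d₀ d₁ → ¬ (d₀ ≡ true × d₁ ≡ true) →
                     signed d₀ (+ k) + signed d₁ (+ k) ≡ -[1+ 1 ] * + onNegative s k
  excess-not-in-in pos             k o _     = excess-positive (+ k) o
  excess-not-in-in neg {d₁ = true}  k refl in-in = contradiction (refl , refl) in-in
  excess-not-in-in neg {d₁ = false} k refl _     = double (+ k)
    where
    double : ∀ z → - z + - z ≡ -[1+ 1 ] * z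
    double = solve-∀

  onNegative≢0 : ∀ s k → onNegative s k ≢ 0 → s ≡ neg
  onNegative≢0 pos k ≢0 = contradiction refl ≢0
  onNegative≢0 neg k _  = refl

  negativePart : Signature m → (Fin m → ℕ) → Fin m → ℕ
  negativePart σ φ e = onNegative (σ e) (φ e)

  -- If no edge points into both of its ends, the excess of an edge is minus twice its negative part.
  sum-negativePart≡1 : ∀ {σ : Signature m} {D} → IsOrientation σ D → (φ : Fin m → ℕ) →
    (∀ e → ¬ (D e false ≡ true × D e true ≡ true)) →
    sum (edgeExcess D (λ e → + φ e)) ≡ -[1+ 1 ] → sumℕ (negativePart σ φ) ≡ 1
  sum-negativePart≡1 {m = m} {σ = σ} {D} o φ no-in-in Σexcess≡-2 =
    ℤ.+-injective (ℤ.*-cancelˡ-≡ -[1+ 1 ] (+ sumℕ ω) (+ 1) (begin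
      -[1+ 1 ] * + sumℕ ω                ≡⟨ cong (-[1+ 1 ] *_) (sum-ℕ ω) ⟨
      -[1+ 1 ] * sum (λ e → + ω e)       ≡⟨ *-distribˡ-sum -[1+ 1 ] (λ e → + ω e) ⟩
      sum (λ e → -[1+ 1 ] * + ω e)       ≡⟨ sum-cong-≗ (λ e → excess-not-in-in (σ e) (φ e) (orientedAs o e) (no-in-in e)) ⟨
      sum (edgeExcess D (λ e → + φ e))   ≡⟨ Σexcess≡-2 ⟩
      -[1+ 1 ] * + 1                     ∎))
    where
    open ≡-Reasoning
    ω : Fin m → ℕ
    ω = negativePart σ φ

excess≡-2⇒exactlyOneNegative : ∀ {σ : Signature m} {D} → IsOrientation σ D → (φ : Fin m → ℕ) → (∀ e → 1 ≤ φ e) →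
  (∀ e → ¬ (D e false ≡ true × D e true ≡ true)) →
  sum (edgeExcess D (λ e → + φ e)) ≡ -[1+ 1 ] → ExactlyOneNegative σ
excess≡-2⇒exactlyOneNegative {σ = σ} o φ φ≥1 no-in-in Σexcess≡-2
  with sumℕ≡1 (negativePart σ φ) (sum-negativePart≡1 o φ no-in-in Σexcess≡-2)
... | p , ωp≡1 , rest = p , onNegative≢0 (σ p) (φ p) (subst (_≢ 0) (sym ωp≡1) λ ()) , only-p
  where
  only-p : ∀ e → σ e ≡ neg → e ≡ p
  only-p e e-neg with e ≟ p | rest e
  ... | yes e≡p | _      = e≡p
  ... | no e≢p  | ωe≡0 rewrite e-neg = contradiction (subst (1 ≤_) (ωe≡0 e≢p) (φ≥1 e)) λ ()

-- Reachability

_⊆_ : (Fin n → Bool) → (Fin n → Bool) → Set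
S ⊆ S′ = ∀ w → S w ≡ true → S′ w ≡ true

size : (Fin n → Bool) → ℕ
size S = sumℕ (λ w → if S w then 1 else 0)

size≤n : (S : Fin n → Bool) → size S ≤ n
size≤n {zero}  S = z≤n
size≤n {suc n} S with S zero
... | true  = s≤s (size≤n (S ∘ suc))
... | false = ℕ.m≤n⇒m≤1+n (size≤n (S ∘ suc))

size-mono : (S S′ : Fin n → Bool) → S ⊆ S′ → size S ≤ size S′
size-mono {zero}  S S′ S⊆S′ = z≤n
size-mono {suc n} S S′ S⊆S′ with S zero in S₀ | S′ zero in S′₀
... | true  | true  = s≤s (size-mono (S ∘ suc) (S′ ∘ suc) (S⊆S′ ∘ suc))
... | true  | false = contradiction (trans (sym (S⊆S′ zero S₀)) S′₀) λ ()
... | false | true  = ℕ.m≤n⇒m≤1+n (size-mono (S ∘ suc) (S′ ∘ suc) (S⊆S′ ∘ suc))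
... | false | false = size-mono (S ∘ suc) (S′ ∘ suc) (S⊆S′ ∘ suc)

size-grows : (S S′ : Fin n → Bool) → S ⊆ S′ → ∀ p → S′ p ≡ true → S p ≡ false → size S < size S′
size-grows S S′ S⊆S′ zero S′p Sp rewrite S′p | Sp = s≤s (size-mono (S ∘ suc) (S′ ∘ suc) (S⊆S′ ∘ suc))
size-grows {suc n} S S′ S⊆S′ (suc p) S′p Sp with S zero in S₀ | S′ zero in S′₀
... | true  | true  = s≤s (size-grows (S ∘ suc) (S′ ∘ suc) (S⊆S′ ∘ suc) p S′p Sp)
... | true  | false = contradiction (trans (sym (S⊆S′ zero S₀)) S′₀) λ ()
... | false | true  = ℕ.m≤n⇒m≤1+n (size-grows (S ∘ suc) (S′ ∘ suc) (S⊆S′ ∘ suc) p S′p Sp)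
... | false | false = size-grows (S ∘ suc) (S′ ∘ suc) (S⊆S′ ∘ suc) p S′p Sp

private
  stalls-or-grows : (R : ℕ → Fin n → Bool) → (∀ j → R j ⊆ R (suc j)) →
                    ∀ j → (Σ ℕ λ i → R (suc i) ⊆ R i) ⊎ (j ≤ size (R j))
  stalls-or-grows R grow zero = inj₂ z≤n
  stalls-or-grows R grow (suc j) with stalls-or-grows R grow j
  ... | inj₁ stall = inj₁ stall
  ... | inj₂ j≤size with any? (λ w → (R (suc j) w Bool.≟ true) ×-dec (R j w Bool.≟ false))
  ...   | yes (w , new , old) = inj₂ (ℕ.≤-trans (s≤s j≤size) (size-grows (R j) (R (suc j)) (grow j) w new old))
  ...   | no ¬new = inj₁ (j , stall)
    where
    stall : R (suc j) ⊆ R j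
    stall w new with R j w in old
    ... | true  = refl
    ... | false = contradiction (w , new , old) ¬new

chain-stalls : (R : ℕ → Fin n → Bool) → (∀ j → R j ⊆ R (suc j)) → Σ ℕ λ j → R (suc j) ⊆ R j
chain-stalls {n} R grow with stalls-or-grows R grow (suc n)
... | inj₁ stall   = stall
... | inj₂ n<size = contradiction (size≤n (R (suc n))) (ℕ.<⇒≱ n<size)

AllSteps : ∀ {G : Graph n m} {a c} → (Fin m → Bool → Set) → Walk G a c → Set
AllSteps A []             = ⊤
AllSteps A (step e b _ P) = A e b × AllSteps A P

private
  anyBool? : ∀ {P : Bool → Set} → (∀ b → Dec (P b)) → Dec (Σ Bool P)
  anyBool? {P} P? with P? false | P? true
  ... | yes p | _     = yes (false , p)
  ... | no _  | yes p = yes (true , p)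
  ... | no ¬f | no ¬t = no λ { (false , p) → ¬f p ; (true , p) → ¬t p }

module Reachability (G : Graph n m) {Arc : Fin m → Bool → Set} (arc? : ∀ e b → Dec (Arc e b)) (y : Fin n) where

  StepInto : (Fin n → Bool) → Fin n → Set
  StepInto S w = Σ (Fin m) λ e → Σ Bool λ b → end G e b ≡ w × Arc e b × S (end G e (not b)) ≡ true

  stepInto? : ∀ S w → Dec (StepInto S w)
  stepInto? S w = any? λ e → anyBool? λ b →
    (end G e b ≟ w) ×-dec arc? e b ×-dec (S (end G e (not b)) Bool.≟ true)

  layer : ℕ → Fin n → Bool
  layer zero    w = does (w ≟ y)
  layer (suc j) w = layer j w ∨ does (stepInto? (layer j) w)

  layer-grows : ∀ j → layer j ⊆ layer (suc j)
  layer-grows j w old rewrite old = refl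

  stepInto⇒layer : ∀ j w → StepInto (layer j) w → layer (suc j) w ≡ true
  stepInto⇒layer j w s = trans (cong (layer j w ∨_) (dec-true (stepInto? (layer j) w) s)) (∨-zeroʳ (layer j w))

  layer-target : ∀ j → layer j y ≡ true
  layer-target zero    = dec-true (y ≟ y) refl
  layer-target (suc j) = layer-grows j y (layer-target j)

  PathWithin : ℕ → Fin n → Set
  PathWithin j w = Σ (Walk G w y) λ P → IsPath P × AllSteps Arc P × All (λ z → layer j z ≡ true) (walkVertices P)

  -- the vertex added at layer suc j is new, so the path through it stays simple
  layer-path : ∀ j w → layer j w ≡ true → PathWithin j w
  layer-path zero w _ with w ≟ y
  ... | yes refl = [] , [] ∷ [] , tt , layer-target zero ∷ []
  layer-path (suc j) w _ with layer j w in old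
  ... | true with layer-path j w old
  ...   | P , simple , arcs , within = P , simple , arcs , All.map (layer-grows j _) within
  layer-path (suc j) w _ | false with stepInto? (layer j) w
  ...   | yes s@(e , b , refl , arc , next) with layer-path j (end G e (not b)) next
  ...     | P , simple , arcs , within =
    step e b refl P , All.map (λ z∈j w≡z → contradiction (trans (sym old) (trans (cong (layer j) w≡z) z∈j)) λ ()) within ∷ simple ,
    (arc , arcs) , stepInto⇒layer j w s ∷ All.map (layer-grows j _) within

  private
    stable : Σ ℕ λ N → layer (suc N) ⊆ layer N
    stable = chain-stalls layer layer-grows

  reach : Fin n → Bool
  reach = layer (proj₁ stable)

  reach-target : reach y ≡ true
  reach-target = layer-target (proj₁ stable)

  reach-closed : ∀ e b → Arc e b → reach (end G e (not b)) ≡ true → reach (end G e b) ≡ true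
  reach-closed e b arc next = proj₂ stable (end G e b) (stepInto⇒layer (proj₁ stable) (end G e b) (e , b , refl , arc , next))

  reach-path : ∀ w → reach w ≡ true → Σ (Walk G w y) λ P → IsPath P × AllSteps Arc P
  reach-path w w∈reach with layer-path (proj₁ stable) w w∈reach
  ... | P , simple , arcs , _ = P , simple , arcs

Forward : Signature m → Orientation m → Fin m → Bool → Set
Forward σ D e b = σ e ≡ pos × D e b ≡ false

forward? : ∀ (σ : Signature m) D e b → Dec (Forward σ D e b)
forward? σ D e b with σ e
... | pos = map′ (refl ,_) proj₂ (D e b Bool.≟ false)
... | neg = no λ ()

indicator : Fin m → Fin m → ℕ
indicator e′ e = if does (e′ ≟ e) then 1 else 0

indicator-refl : (e : Fin m) → indicator e e ≡ 1
indicator-refl e rewrite dec-true (e ≟ e) refl = refl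

indicator-≢ : {e′ e : Fin m} → e′ ≢ e → indicator e′ e ≡ 0
indicator-≢ {e′ = e′} {e} e′≢e rewrite dec-false (e′ ≟ e) e′≢e = refl

multiplicity : ∀ {G : Graph n m} {a c} → Walk G a c → Fin m → ℕ
multiplicity []               e = 0
multiplicity (step e′ _ _ P) e = indicator e′ e ℕ.+ multiplicity P e

multiplicity⇒∈ : ∀ {G : Graph n m} {a c} (P : Walk G a c) e → 1 ≤ multiplicity P e → e ∈ walkEdges P
multiplicity⇒∈ (step e′ _ _ P) e 1≤mult with e′ ≟ e
... | yes refl = here refl
... | no _     = there (multiplicity⇒∈ P e 1≤mult)

∈⇒multiplicity : ∀ {G : Graph n m} {a c} (P : Walk G a c) {e} → e ∈ walkEdges P → 1 ≤ multiplicity P e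
∈⇒multiplicity (step e _ _ P) (here refl) rewrite indicator-refl e = s≤s z≤n
∈⇒multiplicity (step e′ _ _ P) {e} (there e∈P) = ℕ.≤-trans (∈⇒multiplicity P e∈P) (ℕ.m≤n+m (multiplicity P e) (indicator e′ e))

module _ {σ : Signature m} {D : Orientation m} (o : IsOrientation σ D) where

  opposite : ∀ e → σ e ≡ pos → ∀ b → D e (not b) ≡ not (D e b)
  opposite e e-pos b with σ e | orientedAs o e
  opposite e refl false | pos | oₑ = sym (trans (cong not oₑ) (not-involutive (D e true)))
  opposite e refl true  | pos | oₑ = oₑ

  toward-other-end : ∀ e b → Forward σ D e b → D e (not b) ≡ true
  toward-other-end e b (e-pos , away) = trans (opposite e e-pos b) (cong not away)

  forward-end : ∀ e → σ e ≡ pos → Σ Bool (Forward σ D e)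
  forward-end e e-pos with D e false in D₀
  ... | false = false , e-pos , D₀
  ... | true  = true , e-pos , trans (opposite e e-pos false) (cong not D₀)

  forward-unique : ∀ e {b b′} → Forward σ D e b → Forward σ D e b′ → b ≡ b′
  forward-unique e {false} {false} _ _ = refl
  forward-unique e {true}  {true}  _ _ = refl
  forward-unique e {false} {true}  fwd fwd′ = contradiction (trans (sym (toward-other-end e false fwd)) (proj₂ fwd′)) λ ()
  forward-unique e {true}  {false} fwd fwd′ = contradiction (trans (sym (toward-other-end e true fwd)) (proj₂ fwd′)) λ ()

module _ {G : Graph n m} {σ : Signature m} {D : Orientation m} (o : IsOrientation σ D) where

  net-forward-edge : ∀ e b → Forward σ D e b → ∀ w →
    net G D (λ e′ → + indicator e e′) w ≡ mass (end G e (not b)) 1ℤ w - mass (end G e b) 1ℤ w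
  net-forward-edge e b fwd w = trans (net-supported-on G D _ w e only-e) (edge b (proj₂ fwd) (toward-other-end o e b fwd))
    where
    only-e : ∀ e′ → e′ ≢ e → + indicator e e′ ≡ +0
    only-e e′ e′≢e = cong +_ (indicator-≢ (e′≢e ∘ sym))
    edge : ∀ b → D e b ≡ false → D e (not b) ≡ true →
           edgeNet G D (λ e′ → + indicator e e′) w e ≡ mass (end G e (not b)) 1ℤ w - mass (end G e b) 1ℤ w
    edge false away toward rewrite indicator-refl e | away | toward =
      trans (cong (_+ mass (end G e true) 1ℤ w) (mass-neg (end G e false) 1ℤ w)) (+-comm (- mass (end G e false) 1ℤ w) (mass (end G e true) 1ℤ w))
    edge true  away toward rewrite indicator-refl e | away | toward =
      cong (λ z → mass (end G e false) 1ℤ w + z) (mass-neg (end G e true) 1ℤ w)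

  net-multiplicity : ∀ {a c} (P : Walk G a c) → AllSteps (Forward σ D) P → ∀ w →
    net G D (λ e → + multiplicity P e) w ≡ mass c 1ℤ w - mass a 1ℤ w
  net-multiplicity {a} [] _ w = trans (net-zero G D w) (sym (+-inverseʳ (mass a 1ℤ w)))
  net-multiplicity {c = c} (step e b refl P) (fwd , fwds) w = begin
    net G D (λ e′ → + indicator e e′ + + multiplicity P e′) w
      ≡⟨ net-+ G D (λ e′ → + indicator e e′) (λ e′ → + multiplicity P e′) w ⟩
    net G D (λ e′ → + indicator e e′) w + net G D (λ e′ → + multiplicity P e′) w
      ≡⟨ cong₂ _+_ (net-forward-edge e b fwd w) (net-multiplicity P fwds w) ⟩
    (mass (end G e (not b)) 1ℤ w - mass (end G e b) 1ℤ w) + (mass c 1ℤ w - mass (end G e (not b)) 1ℤ w)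
      ≡⟨ telescope (mass (end G e (not b)) 1ℤ w) (mass (end G e b) 1ℤ w) (mass c 1ℤ w) ⟩
    mass c 1ℤ w - mass (end G e b) 1ℤ w ∎
    where
    open ≡-Reasoning
    telescope : ∀ x a c → (x - a) + (c - x) ≡ c - a
    telescope = solve-∀

  ∈⇒positive : ∀ {a c} (P : Walk G a c) → AllSteps (Forward σ D) P → ∀ {e} → e ∈ walkEdges P → σ e ≡ pos
  ∈⇒positive (step e b _ P) (fwd , _)    (here refl) = proj₁ fwd
  ∈⇒positive (step e b _ P) (_ , fwds) (there e∈P) = ∈⇒positive P fwds e∈P

  departure : ∀ {a c} (P : Walk G a c) → AllSteps (Forward σ D) P → ∀ {e} → e ∈ walkEdges P →
              Σ Bool λ b → end G e b ∈ walkVertices P × Forward σ D e b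
  departure (step e b refl P) (fwd , _)    (here refl) = b , here refl , fwd
  departure (step e b _ P)    (_ , fwds) (there e∈P) with departure P fwds e∈P
  ... | b′ , start∈P , fwd = b′ , there start∈P , fwd

  -- a second passage through e would start again at the same vertex
  multiplicity≤1 : ∀ {a c} (P : Walk G a c) → IsPath P → AllSteps (Forward σ D) P → ∀ e → multiplicity P e ≤ 1
  multiplicity≤1 [] _ _ e = z≤n
  multiplicity≤1 (step e′ b refl P) (start∉P ∷ simple) (fwd , fwds) e with e′ ≟ e
  ... | no _     = multiplicity≤1 P simple fwds e
  ... | yes refl with multiplicity P e in mult
  ...   | zero  = s≤s z≤n
  ...   | suc _ with departure P fwds (multiplicity⇒∈ P e (subst (1 ≤_) (sym mult) (s≤s z≤n)))
  ...     | b′ , start∈P , fwd′ rewrite forward-unique o e fwd′ fwd = contradiction refl (All.lookup start∉P start∈P)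

closed⇒¬in-in : ∀ {G : Graph n m} {σ D} → IsOrientation σ D → (T : Fin n → Bool) →
  (∀ e b → Forward σ D e b → T (end G e (not b)) ≡ true → T (end G e b) ≡ true) →
  ∀ e → σ e ≡ pos → ¬ (switch G T D e false ≡ true × switch G T D e true ≡ true)
closed⇒¬in-in {G = G} {σ} {D} o T closed e e-pos (in₀ , in₁) with forward-end o e e-pos
... | b , (_ , away) = contradiction (trans (sym (closed e b (e-pos , away) T-head)) (trans (T≡D b) away)) λ ()
  where
  T≡D : ∀ b → T (end G e b) ≡ D e b
  T≡D false = switchAt≡true (T (end G e false)) (D e false) in₀
  T≡D true  = switchAt≡true (T (end G e true)) (D e true) in₁
  T-head : T (end G e (not b)) ≡ true
  T-head = trans (T≡D (not b)) (toward-other-end o e b (e-pos , away))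

-- Nonnegative flows and path augmentation

reverse-isOrientation : ∀ {D : Orientation m} → IsOrientation allPositive D → IsOrientation allPositive (reverse D)
reverse-isOrientation {D = D} o e = cong not (o e)

align-isOrientation : ∀ {D : Orientation m} φ → IsOrientation allPositive D → IsOrientation allPositive (align D φ)
align-isOrientation {D = D} φ o e with φ e
... | + _      = o e
... | -[1+ _ ] = cong not (o e)

private
  reverse-if-needed : ∀ (G : Graph n m) {D φ} → IsFlow G allPositive D φ → ∀ p →
    Σ (Orientation m) λ D₁ → IsOrientation allPositive D₁ × (∀ w → net G D₁ φ w ≡ +0) × D₁ p false ≡ true
  reverse-if-needed G {D} {φ} (o , conserved) p with D p false in Dp
  ... | true  = D , o , net≡0 , Dp
    where
    net≡0 : ∀ w → net G D φ w ≡ +0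
    net≡0 w = conserved⇒net≡0 G D φ w (conserved w)
  ... | false = reverse D , reverse-isOrientation {D = D} o , net≡0 , cong not Dp
    where
    net≡0 : ∀ w → net G (reverse D) φ w ≡ +0
    net≡0 w = trans (net-reverse G D φ w) (cong -_ (conserved⇒net≡0 G D φ w (conserved w)))

nonnegative-flow : ∀ (G : Graph n m) {D φ} → IsFlow G allPositive D φ → ∀ p → + 0 <ℤ φ p →
  Σ (Orientation m) λ D⁺ → IsOrientation allPositive D⁺ × (∀ w → net G D⁺ (λ e → + ∣ φ e ∣) w ≡ +0) × D⁺ p false ≡ true
nonnegative-flow G {D} {φ} flow p φp>0 with reverse-if-needed G {D} flow p
... | D₁ , o₁ , net≡0 , D₁p = align D₁ φ , align-isOrientation {D = D₁} φ o₁ , (λ w → trans (net-align G D₁ φ w) (net≡0 w)) ,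
                              toward φp>0
  where
  toward : + 0 <ℤ φ p → align D₁ φ p false ≡ true
  toward φp>0 with φ p | φp>0
  ... | + _ | _ = D₁p

augmented : ∀ {G : Graph n m} {a c} → (Fin m → ℕ) → Walk G a c → Fin m → ℕ
augmented φ₀ P e = φ₀ e ℕ.+ multiplicity P e

-- φ₀ has one unit of excess inflow at v and one of excess outflow at y, which the path flow cancels.
module Augmentation {G : Graph n m} {σ D} (o : IsOrientation σ D) {K : ℕ}
  (φ₀ : Fin m → ℕ) (φ₀≥1 : ∀ e → 1 ≤ φ₀ e) (φ₀<K : ∀ e → φ₀ e < K)
  {v y} (net₀ : ∀ w → net G D (λ e → + φ₀ e) w ≡ mass v 1ℤ w - mass y 1ℤ w)
  (P : Walk G v y) (simple : IsPath P) (forward : AllSteps (Forward σ D) P) where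

  φ : Fin m → ℤ
  φ e = + augmented φ₀ P e

  augmented-isNZFlow : IsNZFlow G σ (+ K + + 1) D φ
  augmented-isNZFlow = (o , λ w → net≡0⇒conserved G D φ w (net≡0 w)) , λ e → nonzero e , bounded e
    where
    net≡0 : ∀ w → net G D φ w ≡ +0
    net≡0 w = begin
      net G D φ w                                                          ≡⟨ net-+ G D (λ e → + φ₀ e) (λ e → + multiplicity P e) w ⟩
      net G D (λ e → + φ₀ e) w + net G D (λ e → + multiplicity P e) w    ≡⟨ cong₂ _+_ (net₀ w) (net-multiplicity o P forward w) ⟩
      (mass v 1ℤ w - mass y 1ℤ w) + (mass y 1ℤ w - mass v 1ℤ w)          ≡⟨ cancel (mass v 1ℤ w) (mass y 1ℤ w) ⟩
      +0                                                                   ∎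
      where
      open ≡-Reasoning
      cancel : ∀ a b → (a - b) + (b - a) ≡ +0
      cancel = solve-∀
    nonzero : ∀ e → φ e ≢ +0
    nonzero e φe≡0 = contradiction (ℕ.≤-trans (φ₀≥1 e) (ℕ.m≤m+n (φ₀ e) (multiplicity P e))) (subst (λ k → ¬ 1 ≤ k) (sym (ℤ.+-injective φe≡0)) λ ())
    bounded : ∀ e → + ∣ φ e ∣ <ℤ + K + + 1
    bounded e = +<+ (ℕ.+-mono-≤ (φ₀<K e) (multiplicity≤1 o P simple forward e))

  augmented-positive : ∀ e → + 0 <ℤ φ e
  augmented-positive e = +<+ (ℕ.≤-trans (φ₀≥1 e) (ℕ.m≤m+n (φ₀ e) (multiplicity P e)))

  augmented-negative : ∀ e → σ e ≡ neg → φ e ≡ + φ₀ e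
  augmented-negative e e-neg with multiplicity P e in mult
  ... | zero  = cong +_ (ℕ.+-identityʳ (φ₀ e))
  ... | suc _ = contradiction (trans (sym e-neg) (∈⇒positive o P forward (multiplicity⇒∈ P e (subst (1 ≤_) (sym mult) (s≤s z≤n))))) λ ()

  augmented-max⇒on-path : ∀ e → φ e ≡ + K → e ∈ walkEdges P
  augmented-max⇒on-path e φe≡K with multiplicity P e in mult
  ... | zero  = contradiction (trans (sym (ℕ.+-identityʳ (φ₀ e))) (ℤ.+-injective φe≡K)) (ℕ.<⇒≢ (φ₀<K e))
  ... | suc _ = multiplicity⇒∈ P e (subst (1 ≤_) (sym mult) (s≤s z≤n))

  augmented-on-path-≢1 : ∀ e → e ∈ walkEdges P → φ e ≢ + 1
  augmented-on-path-≢1 e e∈P φe≡1 = contradiction (ℤ.+-injective φe≡1) (ℕ.>⇒≢ (ℕ.+-mono-≤ (φ₀≥1 e) (∈⇒multiplicity P e∈P)))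

-- The construction

module Skip2 (e₁ e₂ : Fin (suc (suc m))) (e₁≢e₂ : e₁ ≢ e₂) where

  skip : Fin m → Fin (suc (suc m))
  skip = skip2 e₁ e₂ e₁≢e₂

  skip≢e₁ : ∀ i → skip i ≢ e₁
  skip≢e₁ i = punchInᵢ≢i e₁ (punchIn (punchOut e₁≢e₂) i)

  skip≢e₂ : ∀ i → skip i ≢ e₂
  skip≢e₂ i skip≡e₂ = punchInᵢ≢i (punchOut e₁≢e₂) i
    (punchIn-injective e₁ _ _ (trans skip≡e₂ (sym (punchIn-punchOut e₁≢e₂))))

  skip-injective : ∀ {i j} → skip i ≡ skip j → i ≡ j
  skip-injective {i} {j} eq = punchIn-injective (punchOut e₁≢e₂) i j (punchIn-injective e₁ _ _ eq)

  data View (e : Fin (suc (suc m))) : Set where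
    first  : e ≡ e₁ → View e
    second : e ≡ e₂ → View e
    kept   : ∀ i → skip i ≡ e → View e

  view : ∀ e → View e
  view e with e₁ ≟ e
  ... | yes e₁≡e = first (sym e₁≡e)
  ... | no e₁≢e with punchOut e₁≢e₂ ≟ punchOut e₁≢e
  ...   | yes same  = second (sym (punchOut-injective e₁≢e₂ e₁≢e same))
  ...   | no differ = kept (punchOut differ) (trans (cong (punchIn e₁) (punchIn-punchOut differ)) (punchIn-punchOut e₁≢e))

  module _ {A : Set} (f : Fin m → A) (a b : A) where

    private
      select : ∀ {e} → View e → A
      select (first _)  = a
      select (second _) = b
      select (kept i _) = f i

    extend : Fin (suc (suc m)) → A
    extend e = select (view e)

    extend-e₁ : extend e₁ ≡ a
    extend-e₁ = on-e₁ (view e₁)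
      where
      on-e₁ : (w : View e₁) → select w ≡ a
      on-e₁ (first _)       = refl
      on-e₁ (second e₁≡e₂)  = contradiction e₁≡e₂ e₁≢e₂
      on-e₁ (kept i skip≡e₁) = contradiction skip≡e₁ (skip≢e₁ i)

    extend-e₂ : extend e₂ ≡ b
    extend-e₂ = on-e₂ (view e₂)
      where
      on-e₂ : (w : View e₂) → select w ≡ b
      on-e₂ (first e₂≡e₁)   = contradiction (sym e₂≡e₁) e₁≢e₂
      on-e₂ (second _)      = refl
      on-e₂ (kept i skip≡e₂) = contradiction skip≡e₂ (skip≢e₂ i)

    extend-skip : ∀ i → extend (skip i) ≡ f i
    extend-skip i = on-skip (view (skip i))
      where
      on-skip : (w : View (skip i)) → select w ≡ f i
      on-skip (first skip≡e₁)  = contradiction skip≡e₁ (skip≢e₁ i)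
      on-skip (second skip≡e₂) = contradiction skip≡e₂ (skip≢e₂ i)
      on-skip (kept j skip≡)  = cong f (skip-injective skip≡)

module Construction {n m} (G : Graph n (suc (suc m))) (σ : Signature (suc (suc m)))
  (u v x y : Fin n) (e₁ e₂ : Fin (suc (suc m))) (e₁≢e₂ : e₁ ≢ e₂) (K : ℕ)
  (admissible : FlowAdmissible G σ)
  (only-e₁-e₂ : ∀ e → σ e ≡ neg → (e ≡ e₁ ⊎ e ≡ e₂))
  (e₁-neg : σ e₁ ≡ neg) (e₂-neg : σ e₂ ≡ neg)
  (e₁-ends : HasEnds G e₁ u v) (e₂-ends : HasEnds G e₂ x y)
  (D* : Orientation (suc m)) (φ* : Fin (suc m) → ℤ)
  (flow* : IsNZFlow (Gstar G e₁ e₂ e₁≢e₂ u x) allPositive (+ K) D* φ*) (φ*0≡1 : φ* zero ≡ + 1) where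

  open Skip2 e₁ e₂ e₁≢e₂

  G* : Graph n (suc m)
  G* = Gstar G e₁ e₂ e₁≢e₂ u x

  ψ : Fin (suc m) → ℕ
  ψ e = ∣ φ* e ∣

  ψ≥1 : ∀ e → 1 ≤ ψ e
  ψ≥1 e with φ* e | proj₁ (proj₂ flow* e)
  ... | + zero    | φ*e≢0 = contradiction refl φ*e≢0
  ... | + suc _   | _     = s≤s z≤n
  ... | -[1+ _ ] | _     = s≤s z≤n

  ψ<K : ∀ e → ψ e < K
  ψ<K e with proj₂ (proj₂ flow* e)
  ... | +<+ ψe<K = ψe<K

  1<K : 1 < K
  1<K = subst (_< K) (cong ∣_∣ φ*0≡1) (ψ<K zero)

  private
    normalised : Σ (Orientation (suc m)) λ D⁺ → IsOrientation allPositive D⁺ ×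
                   (∀ w → net G* D⁺ (λ e → + ψ e) w ≡ +0) × D⁺ zero false ≡ true
    normalised = nonnegative-flow G* {D*} {φ*} (proj₁ flow*) zero (subst (+ 0 <ℤ_) (sym φ*0≡1) (+<+ (s≤s z≤n)))

  D⁺ : Orientation (suc m)
  D⁺ = proj₁ normalised

  o⁺ : IsOrientation allPositive D⁺
  o⁺ = proj₁ (proj₂ normalised)

  net⁺≡0 : ∀ w → net G* D⁺ (λ e → + ψ e) w ≡ +0
  net⁺≡0 = proj₁ (proj₂ (proj₂ normalised))

  D⁺-ux : D⁺ zero false ≡ true × D⁺ zero true ≡ false
  D⁺-ux = into-u , trans (sym (not-involutive (D⁺ zero true))) (cong not (trans (sym (o⁺ zero)) into-u))
    where
    into-u : D⁺ zero false ≡ true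
    into-u = proj₂ (proj₂ (proj₂ normalised))

  D : Orientation (suc (suc m))
  D = extend (λ i → D⁺ (suc i)) (λ _ → true) (λ _ → false)

  φ₀ : Fin (suc (suc m)) → ℕ
  φ₀ = extend (λ i → ψ (suc i)) 1 1

  D-e₁ : ∀ b → D e₁ b ≡ true
  D-e₁ b = cong (λ d → d b) (extend-e₁ (λ i → D⁺ (suc i)) (λ _ → true) (λ _ → false))

  D-e₂ : ∀ b → D e₂ b ≡ false
  D-e₂ b = cong (λ d → d b) (extend-e₂ (λ i → D⁺ (suc i)) (λ _ → true) (λ _ → false))

  D-skip : ∀ i b → D (skip i) b ≡ D⁺ (suc i) b
  D-skip i b = cong (λ d → d b) (extend-skip (λ i → D⁺ (suc i)) (λ _ → true) (λ _ → false) i)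

  φ₀-e₁ : φ₀ e₁ ≡ 1
  φ₀-e₁ = extend-e₁ (λ i → ψ (suc i)) 1 1

  φ₀-e₂ : φ₀ e₂ ≡ 1
  φ₀-e₂ = extend-e₂ (λ i → ψ (suc i)) 1 1

  φ₀-skip : ∀ i → φ₀ (skip i) ≡ ψ (suc i)
  φ₀-skip = extend-skip (λ i → ψ (suc i)) 1 1

  σ-skip : ∀ i → σ (skip i) ≡ pos
  σ-skip i with σ (skip i) in σi
  ... | pos = refl
  ... | neg with only-e₁-e₂ (skip i) σi
  ...   | inj₁ skip≡e₁ = contradiction skip≡e₁ (skip≢e₁ i)
  ...   | inj₂ skip≡e₂ = contradiction skip≡e₂ (skip≢e₂ i)

  φ₀≥1 : ∀ e → 1 ≤ φ₀ e
  φ₀≥1 e with view e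
  ... | first _  = s≤s z≤n
  ... | second _ = s≤s z≤n
  ... | kept i _ = ψ≥1 (suc i)

  φ₀<K : ∀ e → φ₀ e < K
  φ₀<K e with view e
  ... | first _  = 1<K
  ... | second _ = 1<K
  ... | kept i _ = ψ<K (suc i)

  o : IsOrientation σ D
  o = isOrientation oriented
    where
    oriented : ∀ e → OrientedAs (σ e) (D e false) (D e true)
    oriented e with view e
    ... | first refl  rewrite e₁-neg   = refl
    ... | second refl rewrite e₂-neg   = refl
    ... | kept i refl rewrite σ-skip i = o⁺ (suc i)

  private
    ends-sum : ∀ {e a c} (f : Fin n → ℤ) → HasEnds G e a c → f (end G e false) + f (end G e true) ≡ f a + f c
    ends-sum f (inj₁ (refl , refl)) = refl
    ends-sum {e} f (inj₂ (refl , refl)) = +-comm (f (end G e false)) (f (end G e true))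

    edgeNet-e₁ : ∀ w → edgeNet G D (λ e → + φ₀ e) w e₁ ≡ mass u 1ℤ w + mass v 1ℤ w
    edgeNet-e₁ w rewrite D-e₁ false | D-e₁ true | φ₀-e₁ = ends-sum (λ a → mass a 1ℤ w) e₁-ends

    edgeNet-e₂ : ∀ w → edgeNet G D (λ e → + φ₀ e) w e₂ ≡ - mass x 1ℤ w - mass y 1ℤ w
    edgeNet-e₂ w rewrite D-e₂ false | D-e₂ true | φ₀-e₂ =
      trans (ends-sum (λ a → mass a (- 1ℤ) w) e₂-ends) (cong₂ _+_ (mass-neg x 1ℤ w) (mass-neg y 1ℤ w))

    edgeNet-skip : ∀ w i → edgeNet G D (λ e → + φ₀ e) w (skip i) ≡ edgeNet G* D⁺ (λ e → + ψ e) w (suc i)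
    edgeNet-skip w i rewrite D-skip i false | D-skip i true | φ₀-skip i = refl

    edgeNet-ux : ∀ w → edgeNet G* D⁺ (λ e → + ψ e) w zero ≡ mass u 1ℤ w - mass x 1ℤ w
    edgeNet-ux w rewrite proj₁ D⁺-ux | proj₂ D⁺-ux | φ*0≡1 = cong (λ z → mass u 1ℤ w + z) (mass-neg x 1ℤ w)

  net₀ : ∀ w → net G D (λ e → + φ₀ e) w ≡ mass v 1ℤ w - mass y 1ℤ w
  net₀ w = begin
    net G D φ₀′ w
      ≡⟨ sum-skip2 e₁ e₂ e₁≢e₂ (edgeNet G D φ₀′ w) ⟩
    edgeNet G D φ₀′ w e₁ + (edgeNet G D φ₀′ w e₂ + sum (λ i → edgeNet G D φ₀′ w (skip i)))
      ≡⟨ cong₂ _+_ (edgeNet-e₁ w) (cong₂ _+_ (edgeNet-e₂ w) (trans (sum-cong-≗ (edgeNet-skip w)) rest)) ⟩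
    (mass u 1ℤ w + mass v 1ℤ w) + ((- mass x 1ℤ w - mass y 1ℤ w) + - (mass u 1ℤ w - mass x 1ℤ w))
      ≡⟨ telescope (mass u 1ℤ w) (mass v 1ℤ w) (mass x 1ℤ w) (mass y 1ℤ w) ⟩
    mass v 1ℤ w - mass y 1ℤ w ∎
    where
    open ≡-Reasoning
    φ₀′ : Fin (suc (suc m)) → ℤ
    φ₀′ e = + φ₀ e
    -- the edges of G* other than ux balance the unit flow on ux
    rest : sum (λ i → edgeNet G* D⁺ (λ e → + ψ e) w (suc i)) ≡ - (mass u 1ℤ w - mass x 1ℤ w)
    rest = trans (inverseʳ-unique _ _ (net⁺≡0 w)) (cong -_ (edgeNet-ux w))
    telescope : ∀ a b c d → (a + b) + ((- c - d) + - (a - c)) ≡ b - d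
    telescope = solve-∀

  open Reachability G (forward? σ D) y using (reach; reach-target; reach-closed; reach-path)

  private
    second-end : ∀ {e a c} {P : Fin n → Set} → HasEnds G e a c → (∀ b → P (end G e b)) → P c
    second-end (inj₁ (_ , refl)) P-ends = P-ends true
    second-end (inj₂ (refl , _)) P-ends = P-ends false

  no-in-in : reach v ≡ false → ∀ e → ¬ (switch G reach D e false ≡ true × switch G reach D e true ≡ true)
  no-in-in v-unreached e (in₀ , in₁) with σ e in σe
  ... | pos = closed⇒¬in-in o reach reach-closed e σe (in₀ , in₁)
  ... | neg with only-e₁-e₂ e σe
  ...   | inj₁ refl = contradiction (trans (sym v-unreached) (second-end {P = λ w → reach w ≡ true} e₁-ends reached)) λ ()
    where
    reached : ∀ b → reach (end G e₁ b) ≡ true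
    reached false = trans (switchAt≡true _ _ in₀) (D-e₁ false)
    reached true  = trans (switchAt≡true _ _ in₁) (D-e₁ true)
  ...   | inj₂ refl = contradiction (trans (sym reach-target) (second-end {P = λ w → reach w ≡ false} e₂-ends unreached)) λ ()
    where
    unreached : ∀ b → reach (end G e₂ b) ≡ false
    unreached false = trans (switchAt≡true _ _ in₀) (D-e₂ false)
    unreached true  = trans (switchAt≡true _ _ in₁) (D-e₂ true)

  excess-after-switching : reach v ≡ false → sum (edgeExcess (switch G reach D) (λ e → + φ₀ e)) ≡ -[1+ 1 ]
  excess-after-switching v-unreached = begin
    sum (edgeExcess (switch G reach D) (λ e → + φ₀ e))              ≡⟨ sum-sgn-net G reach D (λ e → + φ₀ e) ⟨
    sum (λ w → sgn (reach w) * net G D (λ e → + φ₀ e) w)            ≡⟨ sum-cong-≗ (λ w → cong (sgn (reach w) *_) (net₀ w)) ⟩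
    sum (λ w → sgn (reach w) * (mass v 1ℤ w - mass y 1ℤ w))        ≡⟨ sum-*-dipole (sgn ∘ reach) v y ⟩
    sgn (reach v) - sgn (reach y)                                   ≡⟨ cong₂ (λ s t → sgn s - sgn t) v-unreached reach-target ⟩
    -[1+ 1 ]                                                        ∎
    where open ≡-Reasoning

  v-reaches : reach v ≡ true
  v-reaches with reach v in v∈
  ... | true  = refl
  ... | false = contradiction
    (excess≡-2⇒exactlyOneNegative (switch-isOrientation G reach o) φ₀ φ₀≥1 (no-in-in v∈) (excess-after-switching v∈))
    (switchSign-exactlyOneNegative⇒¬admissible G σ reach admissible)

  path : Σ (Walk G v y) λ P → IsPath P × AllSteps (Forward σ D) P
  path = reach-path v v-reaches

  open Augmentation o φ₀ φ₀≥1 φ₀<K net₀ (proj₁ path) (proj₁ (proj₂ path)) (proj₂ (proj₂ path)) public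

mainTheorem4 : ∀ {n m} (G : Graph n (suc (suc m))) (σ : Signature (suc (suc m)))
    (u v x y : Fin n) (e₁ e₂ : Fin (suc (suc m))) (ne : e₁ ≢ e₂) (k : ℤ) →
    Cubic G →
    FlowAdmissible G σ →
    (∀ e → σ e ≡ neg → (e ≡ e₁ ⊎ e ≡ e₂)) →
    σ e₁ ≡ neg → σ e₂ ≡ neg →
    HasEnds G e₁ u v → HasEnds G e₂ x y →
    (Σ (Orientation (suc m)) λ D* → Σ (Fin (suc m) → ℤ) λ φ* →
       IsNZFlow (Gstar G e₁ e₂ ne u x) allPositive k D* φ* × φ* zero ≡ + 1) →
    Σ (Orientation (suc (suc m))) λ D → Σ (Fin (suc (suc m)) → ℤ) λ φ →
      IsNZFlow G σ (k + + 1) D φ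
      × (∀ e → + 0 <ℤ φ e)
      × (φ e₁ ≡ + 1 × φ e₂ ≡ + 1)
      × (Σ (Walk G v y) λ P → IsPath P
           × (∀ e → φ e ≡ k → e ∈ walkEdges P)
           × (∀ e → e ∈ walkEdges P → φ e ≢ + 1))
mainTheorem4 G σ u v x y e₁ e₂ e₁≢e₂ -[1+ _ ] _ _ _ _ _ _ _ (_ , _ , flow* , _) with proj₂ (proj₂ flow* zero)
... | ()
mainTheorem4 G σ u v x y e₁ e₂ e₁≢e₂ (+ K) _ admissible only-e₁-e₂ e₁-neg e₂-neg e₁-ends e₂-ends (D* , φ* , flow* , φ*0≡1) =
  D , φ , augmented-isNZFlow , augmented-positive ,
  (trans (augmented-negative e₁ e₁-neg) (cong +_ φ₀-e₁) , trans (augmented-negative e₂ e₂-neg) (cong +_ φ₀-e₂)) ,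
  proj₁ path , proj₁ (proj₂ path) , augmented-max⇒on-path , augmented-on-path-≢1
  where
  open Construction G σ u v x y e₁ e₂ e₁≢e₂ K admissible only-e₁-e₂ e₁-neg e₂-neg e₁-ends e₂-ends D* φ* flow* φ*0≡1
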